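{- Let $\Psi\in\{\mathfrak F,\mathfrak B\}$, let $\alpha,\beta$ satisfy $2<\alpha\le 3$ and $4\alpha-\beta=6$, and let $G\in\mathcal G(\Psi,\alpha,\beta)$. Then $G$ is 4-connected, and $G$ has no vertex cut $M$ with $G|_M$ isomorphic to $K_4$.
   Context: All graphs are finite and simple. $|G|$ is the number of vertices, $e(G)$ the number of edges, $G|_X$ the subgraph induced on $X$. $q_{\alpha,\beta}(G)=\alpha|G|-e(G)-\beta$. $\mathfrak F$ is the class of forests and $\mathfrak B$ the class of bipartite graphs. A vertex cut is a vertex set whose removal disconnects the graph; a $\Psi$-cut of $G$ is a vertex cut $M$ with $G|_M\in\Psi$. $\mathcal G(\Psi,\alpha,\beta)$ is the set of graphs $G$ such that $|G|\ge4$, $q_{\alpha,\beta}(G)>0$, $G$ has no $\Psi$-cut, and $G$ has the smallest number of vertices among all graphs with these three properties. -}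

module Defs where

open import Level using (Level; 0ℓ)
open import Data.Bool using (Bool; true; false; if_then_else_; _∧_)
open import Data.Nat as ℕ using (ℕ; zero; suc; _≤_)
open import Data.Nat.Base using (_<ᵇ_)
open import Data.Fin using (Fin; toℕ; zero; suc; fromℕ<)
open import Data.Fin.Subset using (Subset; _∈_; _∉_; ∣_∣)
open import Data.List using (List; map; allFin)
open import Data.Nat.ListAction using (sum)
open import Data.Integer using (+_)
open import Data.Rational using (ℚ; _/_; _+_; _*_; _-_; _<_; 0ℚ)
open import Data.Product using (Σ; _×_; ∃; ∃-syntax)
open import Data.Sum using (_⊎_)
open import Relation.Binary.PropositionalEquality using (_≡_; _≢_)
open import Relation.Nullary using (¬_; yes; no)
open import Function.Bundles using (_⇔_)
open import Function.Definitions using (Injective)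

-- Real numbers, as Dedekind cuts on ℚ (L = rationals below, U = above)

record ℝ : Set₁ where
  field
    L : ℚ → Set
    U : ℚ → Set
    L-inhabited : ∃[ q ] L q
    U-inhabited : ∃[ q ] U q
    L-rounded : ∀ q → L q ⇔ (∃[ r ] (q < r × L r))
    U-rounded : ∀ q → U q ⇔ (∃[ r ] (r < q × U r))
    disjoint : ∀ q → ¬ (L q × U q)
    located : ∀ q r → q < r → L q ⊎ U r
open ℝ public

ℕ→ℚ : ℕ → ℚ
ℕ→ℚ n = + n / 1

_<ᴿ_ : ℚ → ℝ → Set
q <ᴿ x = L x q

_≤ᴿ_ : ℝ → ℚ → Set
x ≤ᴿ q = ¬ (L x q)

-- 4α − β = 6 as an equality of real numbers, expressed through lower cuts:
-- the lower cut of 4α − β is { r | ∃ a < α, b > β, r < 4a − b }.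
FourAlphaMinusBetaIsSix : ℝ → ℝ → Set
FourAlphaMinusBetaIsSix α β =
  ∀ r → (∃[ a ] ∃[ b ] (L α a × U β b × r < ℕ→ℚ 4 * a - b)) ⇔ (r < ℕ→ℚ 6)

record Graph (n : ℕ) : Set where
  field
    adj : Fin n → Fin n → Bool
    sym : ∀ i j → adj i j ≡ adj j i
    irrefl : ∀ i → adj i i ≡ false
open Graph public

e : ∀ {n} → Graph n → ℕ
e {n} G = sum (map (λ i → sum (map (λ j →
            if (toℕ i <ᵇ toℕ j) ∧ adj G i j then 1 else 0) (allFin n))) (allFin n))

qPos : ∀ {n} → ℝ → ℝ → Graph n → Set
qPos {n} α β G =
  ∃[ a ] ∃[ b ] (L α a × U β b × 0ℚ < a * ℕ→ℚ n - ℕ→ℚ (e G) - b)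

data Reach {n} (G : Graph n) (M : Subset n) : Fin n → Fin n → Set where
  here : ∀ {u} → u ∉ M → Reach G M u u
  step : ∀ {u v w} → u ∉ M → adj G u v ≡ true → Reach G M v w → Reach G M u w

VertexCut : ∀ {n} → Graph n → Subset n → Set
VertexCut G M = ∃[ u ] ∃[ v ] (u ∉ M × v ∉ M × ¬ Reach G M u v)

next : ∀ {k} → Fin k → Fin k
next {suc k} i with ℕ.suc (toℕ i) ℕ.<? suc k
... | yes p = fromℕ< p
... | no _ = zero

InducedForest : ∀ {n} → Graph n → Subset n → Set
InducedForest {n} G M =
  ∀ k (f : Fin k → Fin n) → 3 ≤ k → Injective _≡_ _≡_ f → (∀ i → f i ∈ M) →
    ¬ (∀ i → adj G (f i) (f (next i)) ≡ true)

InducedBipartite : ∀ {n} → Graph n → Subset n → Set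
InducedBipartite {n} G M =
  Σ (Fin n → Bool) λ c → ∀ i j → i ∈ M → j ∈ M → adj G i j ≡ true → c i ≢ c j

data Class : Set where
  𝔉 𝔅 : Class

InducedIn : Class → ∀ {n} → Graph n → Subset n → Set
InducedIn 𝔉 G M = InducedForest G M
InducedIn 𝔅 G M = InducedBipartite G M

ΨCut : Class → ∀ {n} → Graph n → Subset n → Set
ΨCut Ψ G M = VertexCut G M × InducedIn Ψ G M

Admissible : Class → ℝ → ℝ → ∀ {n} → Graph n → Set
Admissible Ψ α β {n} G = 4 ≤ n × qPos α β G × (∀ M → ¬ ΨCut Ψ G M)

In𝒢 : Class → ℝ → ℝ → ∀ {n} → Graph n → Set
In𝒢 Ψ α β {n} G =
  Admissible Ψ α β G × (∀ m (H : Graph m) → Admissible Ψ α β H → n ≤ m)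

KConnected : ℕ → ∀ {n} → Graph n → Set
KConnected k {n} G = k ℕ.< n × (∀ M → ∣ M ∣ ℕ.< k → ¬ VertexCut G M)

InducedK4 : ∀ {n} → Graph n → Subset n → Set
InducedK4 G M = ∣ M ∣ ≡ 4 × (∀ i j → i ∈ M → j ∈ M → i ≢ j → adj G i j ≡ true)

-- A vertex set M with
-- |M| ≤ 3 that is not a triangle induces a bipartite graph, and a bipartite graph on at most
-- three vertices is a forest, so such an M is never a cut.  Suppose a clique M on 3 or 4
-- vertices separated G into sides A and B.  A path leaving A ∪ M must re-enter it through M,
-- so G[A ∪ M] and G[B ∪ M] again have no Ψ-cut; both have at least 4 and fewer than |G|
-- vertices, and q(G[A ∪ M]) + q(G[B ∪ M]) = q(G) + q(K_|M|) > 0 because q(K₃) = 3 − α ≥ 0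
-- and q(K₄) = 4α − 6 − β = 0.  So one side contradicts the minimality of G.  Finally |G| = 4
-- is impossible: q(G) > 0 forces a non-edge ij, and the two other vertices form a Ψ-cut.
module Submission where

open import Defs hiding (sym)
open import Data.Nat as ℕ using (ℕ; zero; suc)
import Data.Nat.Properties as ℕ
open import Data.Product using (Σ; _×_; _,_; ∃; ∃-syntax; proj₁; proj₂)
open import Data.Sum as Sum using (_⊎_; inj₁; inj₂; [_,_]′)
open import Data.Empty using (⊥; ⊥-elim)
open import Relation.Nullary using (¬_; Dec; yes; no; does; ¬?; _×-dec_; ¬¬-excluded-middle)
open import Relation.Binary.PropositionalEquality hiding ([_])
open import Function.Bundles using (Equivalence)

module Approximation where
  open import Data.Integer as ℤ using (+_)
  import Data.Integer.Properties as ℤ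
  open import Data.Rational
  open import Data.Rational.Properties
  open import Data.Rational.Solver using (module +-*-Solver)
  import Data.Nat.Coprimality as Coprimality
  open +-*-Solver

  ℕ→ℚ≡mkℚ : ∀ n → ℕ→ℚ n ≡ mkℚ (+ n) 0 (Coprimality.sym (Coprimality.1-coprimeTo n))
  ℕ→ℚ≡mkℚ n = ↥p/↧p≡p (mkℚ (+ n) 0 _)

  ℕ→ℚ-+ : ∀ m n → ℕ→ℚ (m ℕ.+ n) ≡ ℕ→ℚ m + ℕ→ℚ n
  ℕ→ℚ-+ m n rewrite ℕ→ℚ≡mkℚ m | ℕ→ℚ≡mkℚ n =
    cong (_/ 1) (trans (ℤ.pos-+ m n)
      (sym (cong₂ ℤ._+_ (ℤ.*-identityʳ (+ m)) (ℤ.*-identityʳ (+ n)))))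

  ℕ→ℚ-nonNeg : ∀ n → NonNegative (ℕ→ℚ n)
  ℕ→ℚ-nonNeg n = normalize-nonNeg n 1

  ℕ→ℚ-mono-≤ : ∀ {m n} → m ℕ.≤ n → ℕ→ℚ m ≤ ℕ→ℚ n
  ℕ→ℚ-mono-≤ {m} {n} m≤n with ℕ.m≤n⇒∃[o]m+o≡n m≤n
  ... | o , refl = begin
    ℕ→ℚ m             ≡⟨ +-identityʳ (ℕ→ℚ m) ⟨
    ℕ→ℚ m + 0ℚ        ≤⟨ +-monoʳ-≤ (ℕ→ℚ m) (nonNegative⁻¹ (ℕ→ℚ o) {{ℕ→ℚ-nonNeg o}}) ⟩
    ℕ→ℚ m + ℕ→ℚ o     ≡⟨ ℕ→ℚ-+ m o ⟨
    ℕ→ℚ (m ℕ.+ o)     ∎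
    where open ≤-Reasoning

  Q : ℚ → ℚ → ℕ → ℕ → ℚ
  Q a b n m = a * ℕ→ℚ n - ℕ→ℚ m - b

  QPos : ℝ → ℝ → ℕ → ℕ → Set
  QPos α β n m = ∃[ a ] ∃[ b ] (a <ᴿ α × U β b × 0ℚ < Q a b n m)

  Q-mono : ∀ {a a′ b b′} n m → a ≤ a′ → b′ ≤ b → Q a b n m ≤ Q a′ b′ n m
  Q-mono n m a≤a′ b′≤b = +-mono-≤
    (+-monoˡ-≤ (- ℕ→ℚ m) (*-monoʳ-≤-nonNeg (ℕ→ℚ n) {{ℕ→ℚ-nonNeg n}} a≤a′))
    (neg-antimono-≤ b′≤b)

  Q-antimono : ∀ a b n {m m′} → m ℕ.≤ m′ → Q a b n m′ ≤ Q a b n m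
  Q-antimono a b n m≤m′ =
    +-monoˡ-≤ (- b) (+-monoʳ-≤ (a * ℕ→ℚ n) (neg-antimono-≤ (ℕ→ℚ-mono-≤ m≤m′)))

  Q-+ : ∀ a b n₁ m₁ n₂ m₂ →
        Q a b n₁ m₁ + Q a b n₂ m₂ ≡ a * ℕ→ℚ (n₁ ℕ.+ n₂) - ℕ→ℚ (m₁ ℕ.+ m₂) - b - b
  Q-+ a b n₁ m₁ n₂ m₂ rewrite ℕ→ℚ-+ n₁ n₂ | ℕ→ℚ-+ m₁ m₂ = identity a b _ _ _ _
    where
    identity : ∀ a b x y z w → (a * x - y - b) + (a * z - w - b) ≡ a * (x + z) - (y + w) - b - b
    identity = solve 6 (λ a b x y z w →
      (a :* x :- y :- b) :+ (a :* z :- w :- b) := a :* (x :+ z) :- (y :+ w) :- b :- b) refl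

  Q-additive : ∀ a b {n k n₁ n₂ m c m₁ m₂} → n ℕ.+ k ≡ n₁ ℕ.+ n₂ → m ℕ.+ c ≡ m₁ ℕ.+ m₂ →
               Q a b n₁ m₁ + Q a b n₂ m₂ ≡ Q a b n m + Q a b k c
  Q-additive a b {n} {k} {n₁} {n₂} {m} {c} {m₁} {m₂} eqn eqm = begin
    Q a b n₁ m₁ + Q a b n₂ m₂                                     ≡⟨ Q-+ a b n₁ m₁ n₂ m₂ ⟩
    a * ℕ→ℚ (n₁ ℕ.+ n₂) - ℕ→ℚ (m₁ ℕ.+ m₂) - b - b                 ≡⟨ cong₂ (λ x y → a * ℕ→ℚ x - ℕ→ℚ y - b - b) eqn eqm ⟨
    a * ℕ→ℚ (n ℕ.+ k) - ℕ→ℚ (m ℕ.+ c) - b - b                     ≡⟨ Q-+ a b n m k c ⟨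
    Q a b n m + Q a b k c                                         ∎
    where open ≡-Reasoning

  0<+⇒0<⊎0< : ∀ p q → 0ℚ < p + q → 0ℚ < p ⊎ 0ℚ < q
  0<+⇒0<⊎0< p q 0<p+q with 0ℚ <? p | 0ℚ <? q
  ... | yes 0<p | _       = inj₁ 0<p
  ... | no _    | yes 0<q = inj₂ 0<q
  ... | no 0≮p  | no 0≮q  = ⊥-elim (<-irrefl refl (<-≤-trans 0<p+q (+-mono-≤ (≮⇒≥ 0≮p) (≮⇒≥ 0≮q))))

  <ᴿ-≤ : ∀ α {a q} → α ≤ᴿ q → a <ᴿ α → a ≤ q
  <ᴿ-≤ α {a} {q} α≤q a<α = ≮⇒≥ λ q<a → α≤q (Equivalence.from (L-rounded α q) (a , q<a , a<α))

  ⊔-<ᴿ : ∀ α {a a′} → a <ᴿ α → a′ <ᴿ α → (a ⊔ a′) <ᴿ α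
  ⊔-<ᴿ α {a} {a′} a<α a′<α with ⊔-sel a a′
  ... | inj₁ eq = subst (L α) (sym eq) a<α
  ... | inj₂ eq = subst (L α) (sym eq) a′<α

  ⊓-U : ∀ β {b b′} → U β b → U β b′ → U β (b ⊓ b′)
  ⊓-U β {b} {b′} β<b β<b′ with ⊓-sel b b′
  ... | inj₁ eq = subst (U β) (sym eq) β<b
  ... | inj₂ eq = subst (U β) (sym eq) β<b′

  Q₄₆≡ : ∀ a b → Q a b 4 6 ≡ (ℕ→ℚ 4 * a - b) - ℕ→ℚ 6
  Q₄₆≡ a b = identity a b (ℕ→ℚ 4) (ℕ→ℚ 6)
    where
    identity : ∀ a b x y → a * x - y - b ≡ (x * a - b) - y
    identity = solve 4 (λ a b x y → a :* x :- y :- b := (x :* a :- b) :- y) refl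

  Q₄₆-nonPos : ∀ α β → FourAlphaMinusBetaIsSix α β →
               ∀ {a b} → a <ᴿ α → U β b → Q a b 4 6 ≤ 0ℚ
  Q₄₆-nonPos α β h {a} {b} a<α β<b = begin
    Q a b 4 6                      ≡⟨ Q₄₆≡ a b ⟩
    (ℕ→ℚ 4 * a - b) - ℕ→ℚ 6        ≤⟨ +-monoˡ-≤ (- ℕ→ℚ 6) 4a-b≤6 ⟩
    ℕ→ℚ 6 - ℕ→ℚ 6                  ≡⟨ +-inverseʳ (ℕ→ℚ 6) ⟩
    0ℚ                             ∎
    where
    open ≤-Reasoning
    4a-b≤6 : ℕ→ℚ 4 * a - b ≤ ℕ→ℚ 6
    4a-b≤6 = ≮⇒≥ λ 6<4a-b → <-irrefl refl (Equivalence.to (h (ℕ→ℚ 6)) (a , b , a<α , β<b , 6<4a-b))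

  Q₄₆-approx : ∀ α β → FourAlphaMinusBetaIsSix α β →
               ∀ δ → 0ℚ < δ → ∃[ a ] ∃[ b ] (a <ᴿ α × U β b × - δ < Q a b 4 6)
  Q₄₆-approx α β h δ 0<δ with Equivalence.from (h (ℕ→ℚ 6 - δ)) 6-δ<6
    where
    6-δ<6 : ℕ→ℚ 6 - δ < ℕ→ℚ 6
    6-δ<6 = subst (ℕ→ℚ 6 - δ <_) (+-identityʳ (ℕ→ℚ 6)) (+-monoʳ-< (ℕ→ℚ 6) (neg-antimono-< 0<δ))
  ... | a , b , a<α , β<b , 6-δ<4a-b = a , b , a<α , β<b , (begin-strict
    - δ                            ≡⟨ identity δ (ℕ→ℚ 6) ⟩
    (ℕ→ℚ 6 - δ) - ℕ→ℚ 6            <⟨ +-monoˡ-< (- ℕ→ℚ 6) 6-δ<4a-b ⟩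
    (ℕ→ℚ 4 * a - b) - ℕ→ℚ 6        ≡⟨ Q₄₆≡ a b ⟨
    Q a b 4 6                      ∎)
    where
    open ≤-Reasoning
    identity : ∀ δ s → - δ ≡ (s - δ) - s
    identity = solve 2 (λ δ s → :- δ := (s :- δ) :- s) refl

  -- Q a b 4 6 approximates q(K₄) = 4α − 6 − β = 0.
  Q₄₆≤Q : ℕ → ℕ → Set
  Q₄₆≤Q k c = ∀ {a} b → a ≤ ℕ→ℚ 3 → Q a b 4 6 ≤ Q a b k c

  Q₄₆≤Q₄₆ : Q₄₆≤Q 4 6
  Q₄₆≤Q₄₆ _ _ = ≤-refl

  Q₄₆≤Q₃₃ : Q₄₆≤Q 3 3
  Q₄₆≤Q₃₃ {a} b a≤3 = begin
    Q a b 4 6                                          ≡⟨ +-identityʳ (Q a b 4 6) ⟨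
    Q a b 4 6 + 0ℚ                                     ≤⟨ +-monoʳ-≤ (Q a b 4 6) 0≤3-a ⟩
    Q a b 4 6 + (ℕ→ℚ 3 - a)                            ≡⟨ cong (λ q → q + (ℕ→ℚ 3 - a)) Q₄₆≡Q₃₃-shape ⟩
    (a * (ℕ→ℚ 3 + 1ℚ) - (ℕ→ℚ 3 + ℕ→ℚ 3) - b) + (ℕ→ℚ 3 - a) ≡⟨ identity a b (ℕ→ℚ 3) ⟩
    Q a b 3 3                                          ∎
    where
    open ≤-Reasoning
    Q₄₆≡Q₃₃-shape : Q a b 4 6 ≡ a * (ℕ→ℚ 3 + 1ℚ) - (ℕ→ℚ 3 + ℕ→ℚ 3) - b
    Q₄₆≡Q₃₃-shape = cong₂ (λ p q → a * p - q - b) (ℕ→ℚ-+ 3 1) (ℕ→ℚ-+ 3 3)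
    0≤3-a : 0ℚ ≤ ℕ→ℚ 3 - a
    0≤3-a = subst (_≤ ℕ→ℚ 3 - a) (+-inverseʳ a) (+-monoˡ-≤ (- a) a≤3)
    identity : ∀ a b t → (a * (t + 1ℚ) - (t + t) - b) + (t - a) ≡ a * t - t - b
    identity = solve 3 (λ a b t → (a :* (t :+ con 1ℚ) :- (t :+ t) :- b) :+ (t :- a) := a :* t :- t :- b) refl

  -- The margin δ = Q a₀ b₀ n m > 0 absorbs the approximation error of q(K₄) = 0.
  QPos-split : ∀ α β → α ≤ᴿ ℕ→ℚ 3 → FourAlphaMinusBetaIsSix α β →
               ∀ {k c} → Q₄₆≤Q k c →
               ∀ {n m n₁ m₁ n₂ m₂} → n ℕ.+ k ≡ n₁ ℕ.+ n₂ → m ℕ.+ c ≡ m₁ ℕ.+ m₂ →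
               QPos α β n m → QPos α β n₁ m₁ ⊎ QPos α β n₂ m₂
  QPos-split α β α≤3 h {k} {c} slack {n} {m} {n₁} {m₁} {n₂} {m₂} eqn eqm (a₀ , b₀ , a₀<α , β<b₀ , 0<δ) =
    split (Q₄₆-approx α β h δ 0<δ)
    where
    δ : ℚ
    δ = Q a₀ b₀ n m
    split : ∃[ a₁ ] ∃[ b₁ ] (a₁ <ᴿ α × U β b₁ × - δ < Q a₁ b₁ 4 6) → QPos α β n₁ m₁ ⊎ QPos α β n₂ m₂
    split (a₁ , b₁ , a₁<α , β<b₁ , -δ<q) =
      Sum.map (witness n₁ m₁) (witness n₂ m₂) (0<+⇒0<⊎0< (Q a b n₁ m₁) (Q a b n₂ m₂)
        (subst (0ℚ <_) (sym (Q-additive a b {n} {k} {n₁} {n₂} {m} {c} {m₁} {m₂} eqn eqm)) 0<sum))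
      where
      a b : ℚ
      a = a₀ ⊔ a₁
      b = b₀ ⊓ b₁
      witness : ∀ n′ m′ → 0ℚ < Q a b n′ m′ → QPos α β n′ m′
      witness _ _ 0<q = a , b , ⊔-<ᴿ α a₀<α a₁<α , ⊓-U β β<b₀ β<b₁ , 0<q
      open ≤-Reasoning
      0<sum : 0ℚ < Q a b n m + Q a b k c
      0<sum = begin-strict
        0ℚ                          ≡⟨ +-inverseʳ δ ⟨
        δ - δ                       <⟨ +-mono-≤-< (Q-mono n m (p≤p⊔q a₀ a₁) (p⊓q≤p b₀ b₁)) -δ<q ⟩
        Q a b n m + Q a₁ b₁ 4 6     ≤⟨ +-monoʳ-≤ (Q a b n m) (Q-mono 4 6 (p≤q⊔p a₀ a₁) (p⊓q≤q b₀ b₁)) ⟩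
        Q a b n m + Q a b 4 6       ≤⟨ +-monoʳ-≤ (Q a b n m) (slack b (<ᴿ-≤ α α≤3 (⊔-<ᴿ α a₀<α a₁<α))) ⟩
        Q a b n m + Q a b k c       ∎

  QPos₄⇒<6 : ∀ α β → FourAlphaMinusBetaIsSix α β → ∀ {m} → QPos α β 4 m → m ℕ.< 6
  QPos₄⇒<6 α β h {m} (a , b , a<α , β<b , 0<q) = ℕ.≰⇒> λ 6≤m → <-irrefl refl (begin-strict
    0ℚ          <⟨ 0<q ⟩
    Q a b 4 m   ≤⟨ Q-antimono a b 4 6≤m ⟩
    Q a b 4 6   ≤⟨ Q₄₆-nonPos α β h a<α β<b ⟩
    0ℚ          ∎)
    where open ≤-Reasoning

open Approximation using (QPos; QPos-split; QPos₄⇒<6; Q₄₆≤Q; Q₄₆≤Q₃₃; Q₄₆≤Q₄₆)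

open import Data.Nat using (_+_; _≤_; _<_; _<ᵇ_; z≤n; s≤s)
open import Data.Bool using (Bool; true; false; if_then_else_; _∧_; _∨_; not; T)
import Data.Bool.Properties as Bool
open import Data.Fin using (Fin; zero; suc; toℕ)
import Data.Fin.Properties as Fin
open import Data.Fin.Subset using (Subset; _∈_; _∉_; ∣_∣; ⊤; _∪_; _-_; Nonempty)
import Data.Fin.Subset.Properties as Subset
open import Data.Vec using ([]; _∷_; lookup; tabulate; here; there)
import Data.Vec.Properties as Vec
import Data.List as List hiding (sum)
import Data.List.Properties as List
import Data.Nat.ListAction as List
open import Algebra.Properties.CommutativeMonoid.Sum ℕ.+-0-commutativeMonoid
  using (sum; sum-syntax; sum-cong-≗; ∑-distrib-+; sum-replicate-zero)
open import Function using (_∘_)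
open import Data.Unit using (tt)
open import Function.Definitions using (Injective)

infixr 7 _·_
_·_ : Bool → ℕ → ℕ
b · x = if b then x else 0

indicator : ∀ {n} → Subset n → Fin n → ℕ
indicator X i = lookup X i · 1

sum-tabulate : ∀ {n} (f : Fin n → ℕ) → List.sum (List.tabulate f) ≡ sum f
sum-tabulate {zero} f = refl
sum-tabulate {suc n} f = cong (f zero +_) (sum-tabulate (f ∘ suc))

sum-allFin : ∀ {n} (f : Fin n → ℕ) → List.sum (List.map f (List.allFin n)) ≡ sum f
sum-allFin f = trans (cong List.sum (List.map-tabulate (λ i → i) f)) (sum-tabulate f)

∑-ones : ∀ n → ∑[ i < n ] 1 ≡ n
∑-ones zero = refl
∑-ones (suc n) = cong suc (∑-ones n)

·-∑ : ∀ {n} b (g : Fin n → ℕ) → b · sum g ≡ ∑[ j < n ] (b · g j)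
·-∑ true g = refl
·-∑ {n} false g = sym (sum-replicate-zero n)

∑∑-distrib-+ : ∀ {n} (f g : Fin n → Fin n → ℕ) →
  ∑[ i < n ] ∑[ j < n ] (f i j + g i j) ≡ ∑[ i < n ] ∑[ j < n ] f i j + ∑[ i < n ] ∑[ j < n ] g i j
∑∑-distrib-+ f g = trans (sum-cong-≗ (λ i → ∑-distrib-+ (f i) (g i))) (∑-distrib-+ (sum ∘ f) (sum ∘ g))

∑∑-cong : ∀ {n} {f g : Fin n → Fin n → ℕ} → (∀ i j → f i j ≡ g i j) →
  ∑[ i < n ] ∑[ j < n ] f i j ≡ ∑[ i < n ] ∑[ j < n ] g i j
∑∑-cong f≗g = sum-cong-≗ (λ i → sum-cong-≗ (f≗g i))

-- Subsets of Fin n and induced subgraphs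

embed : ∀ {n} (X : Subset n) → Fin ∣ X ∣ → Fin n
embed (true ∷ X) zero = zero
embed (true ∷ X) (suc j) = suc (embed X j)
embed (false ∷ X) j = suc (embed X j)

embed-∈ : ∀ {n} (X : Subset n) j → embed X j ∈ X
embed-∈ (true ∷ X) zero = here
embed-∈ (true ∷ X) (suc j) = there (embed-∈ X j)
embed-∈ (false ∷ X) j = there (embed-∈ X j)

index : ∀ {n} (X : Subset n) {i} → i ∈ X → Fin ∣ X ∣
index (true ∷ X) here = zero
index (true ∷ X) (there i∈X) = suc (index X i∈X)
index (false ∷ X) (there i∈X) = index X i∈X

embed-index : ∀ {n} (X : Subset n) {i} (i∈X : i ∈ X) → embed X (index X i∈X) ≡ i
embed-index (true ∷ X) here = refl
embed-index (true ∷ X) (there i∈X) = cong suc (embed-index X i∈X)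
embed-index (false ∷ X) (there i∈X) = cong suc (embed-index X i∈X)

index-embed : ∀ {n} (X : Subset n) j → index X (embed-∈ X j) ≡ j
index-embed (true ∷ X) zero = refl
index-embed (true ∷ X) (suc j) = cong suc (index-embed X j)
index-embed (false ∷ X) j = index-embed X j

index-irrelevant : ∀ {n} (X : Subset n) {i} (p q : i ∈ X) → index X p ≡ index X q
index-irrelevant (true ∷ X) here here = refl
index-irrelevant (true ∷ X) (there p) (there q) = cong suc (index-irrelevant X p q)
index-irrelevant (false ∷ X) (there p) (there q) = index-irrelevant X p q

index-cong : ∀ {n} (X : Subset n) {i j} (i∈X : i ∈ X) (j∈X : j ∈ X) → i ≡ j → index X i∈X ≡ index X j∈X
index-cong X i∈X j∈X refl = index-irrelevant X i∈X j∈X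

index-injective : ∀ {n} (X : Subset n) {i j} (i∈X : i ∈ X) (j∈X : j ∈ X) → index X i∈X ≡ index X j∈X → i ≡ j
index-injective X {i} {j} i∈X j∈X eq =
  trans (sym (embed-index X i∈X)) (trans (cong (embed X) eq) (embed-index X j∈X))

embed-injective : ∀ {n} (X : Subset n) → Injective _≡_ _≡_ (embed X)
embed-injective X {i} {j} eq =
  trans (sym (index-embed X i)) (trans (index-cong X (embed-∈ X i) (embed-∈ X j) eq) (index-embed X j))

embed-<ᵇ : ∀ {n} (X : Subset n) i j → (toℕ (embed X i) <ᵇ toℕ (embed X j)) ≡ (toℕ i <ᵇ toℕ j)
embed-<ᵇ (true ∷ X) zero zero = refl
embed-<ᵇ (true ∷ X) zero (suc j) = refl
embed-<ᵇ (true ∷ X) (suc i) zero = refl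
embed-<ᵇ (true ∷ X) (suc i) (suc j) = embed-<ᵇ X i j
embed-<ᵇ (false ∷ X) i j = embed-<ᵇ X i j

∑-embed : ∀ {n} (X : Subset n) (g : Fin n → ℕ) → ∑[ j < ∣ X ∣ ] g (embed X j) ≡ ∑[ i < n ] (lookup X i · g i)
∑-embed [] g = refl
∑-embed (true ∷ X) g = cong (g zero +_) (∑-embed X (g ∘ suc))
∑-embed (false ∷ X) g = ∑-embed X (g ∘ suc)

∣∣≡∑ : ∀ {n} (X : Subset n) → ∣ X ∣ ≡ ∑[ i < n ] indicator X i
∣∣≡∑ [] = refl
∣∣≡∑ (true ∷ X) = cong suc (∣∣≡∑ X)
∣∣≡∑ (false ∷ X) = ∣∣≡∑ X

∉⇒∣∣< : ∀ {n} (X : Subset n) {i} → i ∉ X → ∣ X ∣ < n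
∉⇒∣∣< {n} X {i} i∉X = subst (∣ X ∣ <_) (Subset.∣⊤∣≡n n)
  (Subset.p⊂q⇒∣p∣<∣q∣ (Subset.⊆⊤ , i , Subset.∈⊤ , i∉X))

injective⇒≤∣∣ : ∀ {n k} (X : Subset n) (f : Fin k → Fin n) → Injective _≡_ _≡_ f → (∀ i → f i ∈ X) → k ≤ ∣ X ∣
injective⇒≤∣∣ X f f-inj f∈X =
  Fin.injective⇒≤ {f = λ i → index X (f∈X i)} λ eq → f-inj (index-injective X (f∈X _) (f∈X _) eq)

≤∣-∣⇒<∣∣ : ∀ {n k x} {p : Subset n} → x ∈ p → k ≤ ∣ p - x ∣ → k < ∣ p ∣
≤∣-∣⇒<∣∣ x∈p k≤ = ℕ.≤-<-trans k≤ (Subset.x∈p⇒∣p-x∣<∣p∣ x∈p)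

distinct₃⇒3≤∣∣ : ∀ {n x y z} {p : Subset n} → x ∈ p → y ∈ p → z ∈ p →
                  x ≢ y → x ≢ z → y ≢ z → 3 ≤ ∣ p ∣
distinct₃⇒3≤∣∣ x∈p y∈p z∈p x≢y x≢z y≢z =
  ≤∣-∣⇒<∣∣ x∈p (≤∣-∣⇒<∣∣ (Subset.x∈p∧x≢y⇒x∈p-y y∈p (x≢y ∘ sym))
    (≤∣-∣⇒<∣∣ (Subset.x∈p∧x≢y⇒x∈p-y (Subset.x∈p∧x≢y⇒x∈p-y z∈p (x≢z ∘ sym)) (y≢z ∘ sym)) z≤n))

distinct₄⇒4≤∣∣ : ∀ {n x y z w} {p : Subset n} → x ∈ p → y ∈ p → z ∈ p → w ∈ p →
                  x ≢ y → x ≢ z → x ≢ w → y ≢ z → y ≢ w → z ≢ w → 4 ≤ ∣ p ∣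
distinct₄⇒4≤∣∣ {x = x} {p = p} x∈p y∈p z∈p w∈p x≢y x≢z x≢w y≢z y≢w z≢w = ≤∣-∣⇒<∣∣ x∈p
  (distinct₃⇒3≤∣∣ (remove y∈p x≢y) (remove z∈p x≢z) (remove w∈p x≢w) y≢z y≢w z≢w)
  where
  remove : ∀ {v} → v ∈ p → x ≢ v → v ∈ p - x
  remove v∈p x≢v = Subset.x∈p∧x≢y⇒x∈p-y v∈p (x≢v ∘ sym)

x∉p-x : ∀ {n} (p : Subset n) x → x ∉ p - x
x∉p-x (s ∷ p) zero ()
x∉p-x (s ∷ p) (suc x) (there x∈) = x∉p-x p x x∈

∣⊤-i-j∣≤ : ∀ n {i j : Fin n} → i ≢ j → 2 + ∣ ⊤ - i - j ∣ ≤ n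
∣⊤-i-j∣≤ n {i} {j} i≢j = subst (2 + ∣ ⊤ - i - j ∣ ≤_) (Subset.∣⊤∣≡n n)
  (ℕ.≤-trans (s≤s (Subset.x∈p⇒∣p-x∣<∣p∣ (Subset.x∈p∧x≢y⇒x∈p-y (Subset.∈⊤ {x = j}) (i≢j ∘ sym))))
             (Subset.x∈p⇒∣p-x∣<∣p∣ (Subset.∈⊤ {x = i})))

lookup-∪ : ∀ {n} (p q : Subset n) i → lookup (p ∪ q) i ≡ lookup p i ∨ lookup q i
lookup-∪ p q i = Vec.lookup-zipWith _∨_ i p q

lift : ∀ {n} (X : Subset n) → Subset ∣ X ∣ → Subset n
lift [] S = []
lift (true ∷ X) (s ∷ S) = s ∷ lift X S
lift (false ∷ X) S = false ∷ lift X S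

lift-∈ : ∀ {n} (X : Subset n) S {i} → i ∈ lift X S → Σ (i ∈ X) λ i∈X → index X i∈X ∈ S
lift-∈ (true ∷ X) (true ∷ S) here = here , here
lift-∈ (true ∷ X) (s ∷ S) (there i∈) with lift-∈ X S i∈
... | i∈X , ∈S = there i∈X , there ∈S
lift-∈ (false ∷ X) S (there i∈) with lift-∈ X S i∈
... | i∈X , ∈S = there i∈X , ∈S

∈-lift : ∀ {n} (X : Subset n) S {i} (i∈X : i ∈ X) → index X i∈X ∈ S → i ∈ lift X S
∈-lift (true ∷ X) (true ∷ S) here here = here
∈-lift (true ∷ X) (s ∷ S) (there i∈X) (there ∈S) = there (∈-lift X S i∈X ∈S)
∈-lift (false ∷ X) S (there i∈X) ∈S = there (∈-lift X S i∈X ∈S)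

induced : ∀ {n} → Graph n → (X : Subset n) → Graph ∣ X ∣
induced G X = record
  { adj    = λ i j → adj G (embed X i) (embed X j)
  ; sym    = λ i j → Graph.sym G (embed X i) (embed X j)
  ; irrefl = λ i → irrefl G (embed X i)
  }

adj-index : ∀ {n} (G : Graph n) (X : Subset n) {i j} (i∈X : i ∈ X) (j∈X : j ∈ X) →
            adj G i j ≡ true → adj (induced G X) (index X i∈X) (index X j∈X) ≡ true
adj-index G X i∈X j∈X =
  subst₂ (λ x y → adj G x y ≡ true) (sym (embed-index X i∈X)) (sym (embed-index X j∈X))

embed-∈-lift : ∀ {n} (X : Subset n) S j → embed X j ∈ lift X S → j ∈ S
embed-∈-lift X S j e∈ with lift-∈ X S e∈
... | e∈X , ∈S = subst (_∈ S) (trans (index-irrelevant X e∈X (embed-∈ X j)) (index-embed X j)) ∈S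

inducedIn-lift : ∀ Ψ {n} (G : Graph n) (X : Subset n) (S : Subset ∣ X ∣) →
                 InducedIn Ψ (induced G X) S → InducedIn Ψ G (lift X S)
inducedIn-lift 𝔉 G X S forest k f 3≤k f-inj f∈ cycle = forest k f′ 3≤k f′-inj f′∈S cycle′
  where
  f′ : Fin k → Fin ∣ X ∣
  f′ i = index X (proj₁ (lift-∈ X S (f∈ i)))
  f′-inj : Injective _≡_ _≡_ f′
  f′-inj eq = f-inj (index-injective X _ _ eq)
  f′∈S : ∀ i → f′ i ∈ S
  f′∈S i = proj₂ (lift-∈ X S (f∈ i))
  cycle′ : ∀ i → adj (induced G X) (f′ i) (f′ (next i)) ≡ true
  cycle′ i = adj-index G X _ _ (cycle i)
inducedIn-lift 𝔅 {n} G X S (colour , proper) = colour′ , proper′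
  where
  colour′ : Fin n → Bool
  colour′ i with i Subset.∈? X
  ... | yes i∈X = colour (index X i∈X)
  ... | no _ = false
  colour′-index : ∀ {i} (i∈X : i ∈ X) → colour′ i ≡ colour (index X i∈X)
  colour′-index {i} i∈X with i Subset.∈? X
  ... | yes i∈X′ = cong colour (index-irrelevant X i∈X′ i∈X)
  ... | no i∉X = ⊥-elim (i∉X i∈X)
  proper′ : ∀ i j → i ∈ lift X S → j ∈ lift X S → adj G i j ≡ true → colour′ i ≢ colour′ j
  proper′ i j i∈ j∈ i~j same with lift-∈ X S i∈ | lift-∈ X S j∈
  ... | i∈X , i′∈S | j∈X , j′∈S = proper _ _ i′∈S j′∈S (adj-index G X i∈X j∈X i~j)
    (trans (sym (colour′-index i∈X)) (trans same (colour′-index j∈X)))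

adj⇒≢ : ∀ {n} (G : Graph n) {i j} → adj G i j ≡ true → i ≢ j
adj⇒≢ G {i} i~i refl with () ← trans (sym i~i) (irrefl G i)

edge : ∀ {n} → Graph n → Fin n → Fin n → ℕ
edge G i j = if (toℕ i <ᵇ toℕ j) ∧ adj G i j then 1 else 0

edge-nonAdj : ∀ {n} (G : Graph n) i j → adj G i j ≡ false → edge G i j ≡ 0
edge-nonAdj G i j i≁j rewrite i≁j | Bool.∧-zeroʳ (toℕ i <ᵇ toℕ j) = refl

e≡∑∑ : ∀ {n} (G : Graph n) → e G ≡ ∑[ i < n ] ∑[ j < n ] edge G i j
e≡∑∑ {n} G = trans (sum-allFin (λ i → List.sum (List.map (edge G i) (List.allFin n))))
  (sum-cong-≗ λ i → sum-allFin (edge G i))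

edgeWithin : ∀ {n} → Graph n → Subset n → Fin n → Fin n → ℕ
edgeWithin G X i j = lookup X i · lookup X j · edge G i j

e-induced : ∀ {n} (G : Graph n) (X : Subset n) →
            e (induced G X) ≡ ∑[ i < n ] ∑[ j < n ] edgeWithin G X i j
e-induced {n} G X = begin
  e (induced G X)
    ≡⟨ e≡∑∑ (induced G X) ⟩
  ∑[ i < ∣ X ∣ ] ∑[ j < ∣ X ∣ ] edge (induced G X) i j
    ≡⟨ sum-cong-≗ (λ i → sum-cong-≗ λ j →
         cong (λ b → if b ∧ adj G (embed X i) (embed X j) then 1 else 0) (sym (embed-<ᵇ X i j))) ⟩
  ∑[ i < ∣ X ∣ ] ∑[ j < ∣ X ∣ ] edge G (embed X i) (embed X j)
    ≡⟨ sum-cong-≗ (λ i → ∑-embed X (edge G (embed X i))) ⟩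
  ∑[ i < ∣ X ∣ ] ∑[ j < n ] (lookup X j · edge G (embed X i) j)
    ≡⟨ ∑-embed X (λ i → ∑[ j < n ] (lookup X j · edge G i j)) ⟩
  ∑[ i < n ] (lookup X i · ∑[ j < n ] (lookup X j · edge G i j))
    ≡⟨ sum-cong-≗ (λ i → ·-∑ (lookup X i) (λ j → lookup X j · edge G i j)) ⟩
  ∑[ i < n ] ∑[ j < n ] edgeWithin G X i j
    ∎
  where open ≡-Reasoning

-- e(K_k); pairs 3 and pairs 4 compute to 3 and 6.
pairs : ℕ → ℕ
pairs k = ∑[ i < k ] ∑[ j < k ] (if toℕ i <ᵇ toℕ j then 1 else 0)

Complete : ∀ {n} → Graph n → Set
Complete G = ∀ i j → i ≢ j → adj G i j ≡ true

complete⇒e≡pairs : ∀ {n} (G : Graph n) → Complete G → e G ≡ pairs n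
complete⇒e≡pairs G complete = trans (e≡∑∑ G) (∑∑-cong pointwise)
  where
  pointwise : ∀ i j → edge G i j ≡ (if toℕ i <ᵇ toℕ j then 1 else 0)
  pointwise i j with toℕ i <ᵇ toℕ j in i<j
  ... | false = refl
  ... | true rewrite complete i j (λ { refl → ℕ.<-irrefl refl (ℕ.<ᵇ⇒< (toℕ i) (toℕ i) (subst T (sym i<j) tt)) }) = refl

IsClique : ∀ {n} → Graph n → Subset n → Set
IsClique G M = ∀ i j → i ∈ M → j ∈ M → i ≢ j → adj G i j ≡ true

clique⇒complete : ∀ {n} (G : Graph n) (M : Subset n) → IsClique G M → Complete (induced G M)
clique⇒complete G M clique i j i≢j =
  clique (embed M i) (embed M j) (embed-∈ M i) (embed-∈ M j) (i≢j ∘ embed-injective M)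

clique-or-nonEdge : ∀ {n} (G : Graph n) (M : Subset n) →
  IsClique G M ⊎ ∃[ i ] ∃[ j ] (i ∈ M × j ∈ M × i ≢ j × adj G i j ≡ false)
clique-or-nonEdge G M with Fin.any? (λ i → Fin.any? λ j →
  (i Subset.∈? M) ×-dec (j Subset.∈? M) ×-dec (¬? (i Fin.≟ j)) ×-dec (adj G i j Bool.≟ false))
... | yes (i , j , nonEdge) = inj₂ (i , j , nonEdge)
... | no noNonEdge = inj₁ clique
  where
  clique : IsClique G M
  clique i j i∈M j∈M i≢j with adj G i j in i~j
  ... | true = refl
  ... | false = ⊥-elim (noNonEdge (i , j , i∈M , j∈M , i≢j , i~j))

bipartite-≤2 : ∀ {n} (G : Graph n) (M : Subset n) → ∣ M ∣ ≤ 2 → InducedBipartite G M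
bipartite-≤2 {n} G M ∣M∣≤2 with Subset.nonempty? M
... | no empty = (λ _ → true) , λ i _ i∈M _ _ _ → empty (i , i∈M)
... | yes (x , x∈M) = colour , proper
  where
  colour : Fin n → Bool
  colour i = does (i Fin.≟ x)
  proper : ∀ i j → i ∈ M → j ∈ M → adj G i j ≡ true → colour i ≢ colour j
  proper i j i∈M j∈M i~j with i Fin.≟ x | j Fin.≟ x
  ... | yes refl | yes refl = λ _ → adj⇒≢ G i~j refl
  ... | yes _    | no _     = λ ()
  ... | no _     | yes _    = λ ()
  ... | no i≢x   | no j≢x   = λ _ → ℕ.≤⇒≯ ∣M∣≤2 (distinct₃⇒3≤∣∣ i∈M j∈M x∈M (adj⇒≢ G i~j) i≢x j≢x)

bipartite-nonEdge : ∀ {n} (G : Graph n) (M : Subset n) → ∣ M ∣ ≤ 3 →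
                    ∀ {x y} → x ∈ M → y ∈ M → x ≢ y → adj G x y ≡ false → InducedBipartite G M
bipartite-nonEdge {n} G M ∣M∣≤3 {x} {y} x∈M y∈M x≢y x≁y = colour , proper
  where
  colour : Fin n → Bool
  colour i = does (i Fin.≟ x) ∨ does (i Fin.≟ y)
  proper : ∀ i j → i ∈ M → j ∈ M → adj G i j ≡ true → colour i ≢ colour j
  proper i j i∈M j∈M i~j with i Fin.≟ x | i Fin.≟ y | j Fin.≟ x | j Fin.≟ y
  ... | yes refl | _        | yes refl | _        = λ _ → adj⇒≢ G i~j refl
  ... | yes refl | _        | no _     | yes refl = λ _ → Bool.not-¬ i~j x≁y
  ... | no _     | yes refl | yes refl | _        = λ _ → Bool.not-¬ (trans (Graph.sym G j i) i~j) x≁y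
  ... | no _     | yes refl | no _     | yes refl = λ _ → adj⇒≢ G i~j refl
  ... | yes refl | _        | no _     | no _     = λ ()
  ... | no _     | yes refl | no _     | no _     = λ ()
  ... | no _     | no _     | yes refl | _        = λ ()
  ... | no _     | no _     | no _     | yes refl = λ ()
  ... | no i≢x   | no i≢y   | no j≢x   | no j≢y   = λ _ → ℕ.≤⇒≯ ∣M∣≤3
    (distinct₄⇒4≤∣∣ i∈M j∈M x∈M y∈M (adj⇒≢ G i~j) i≢x i≢y j≢x j≢y x≢y)

bipartite⇒forest : ∀ {n} (G : Graph n) (M : Subset n) → ∣ M ∣ ≤ 3 → InducedBipartite G M → InducedForest G M
bipartite⇒forest {n} G M ∣M∣≤3 (colour , proper) k f 3≤k f-inj f∈M cycle =
  odd-cycle k (ℕ.≤-antisym (ℕ.≤-trans (injective⇒≤∣∣ M f f-inj f∈M) ∣M∣≤3) 3≤k) f f∈M cycle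
  where
  odd-cycle : ∀ k → k ≡ 3 → (f : Fin k → Fin n) → (∀ i → f i ∈ M) →
              ¬ (∀ i → adj G (f i) (f (next i)) ≡ true)
  odd-cycle .3 refl f f∈M cycle = c≢a (trans (Bool.¬-not (b≢c ∘ sym)) (sym (Bool.¬-not a≢b)))
    where
    a≢b : colour (f zero) ≢ colour (f (suc zero))
    a≢b = proper _ _ (f∈M zero) (f∈M (suc zero)) (cycle zero)
    b≢c : colour (f (suc zero)) ≢ colour (f (suc (suc zero)))
    b≢c = proper _ _ (f∈M (suc zero)) (f∈M (suc (suc zero))) (cycle (suc zero))
    c≢a : colour (f (suc (suc zero))) ≢ colour (f zero)
    c≢a = proper _ _ (f∈M (suc (suc zero))) (f∈M zero) (cycle (suc (suc zero)))

inducedIn-≤3 : ∀ Ψ {n} (G : Graph n) (M : Subset n) → ∣ M ∣ ≤ 3 → InducedBipartite G M → InducedIn Ψ G M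
inducedIn-≤3 𝔉 G M ∣M∣≤3 bipartite = bipartite⇒forest G M ∣M∣≤3 bipartite
inducedIn-≤3 𝔅 G M ∣M∣≤3 bipartite = bipartite

reach-head : ∀ {n} {G : Graph n} {M u v} → Reach G M u v → u ∉ M
reach-head (here u∉M) = u∉M
reach-head (step u∉M _ _) = u∉M

reach-last : ∀ {n} {G : Graph n} {M u v} → Reach G M u v → v ∉ M
reach-last (here v∉M) = v∉M
reach-last (step _ _ r) = reach-last r

reach-snoc : ∀ {n} {G : Graph n} {M u v w} → Reach G M u v → adj G v w ≡ true → w ∉ M → Reach G M u w
reach-snoc (here v∉M) v~w w∉M = step v∉M v~w (here w∉M)
reach-snoc (step u∉M u~x r) v~w w∉M = step u∉M u~x (reach-snoc r v~w w∉M)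

nonEdge-cut : ∀ {n} (G : Graph n) {i j} → i ≢ j → adj G i j ≡ false → VertexCut G (⊤ - i - j)
nonEdge-cut G {i} {j} i≢j i≁j =
  i , j , x∉p-x ⊤ i ∘ Subset.p─q⊆p (⊤ - i) _ , x∉p-x (⊤ - i) j , i≢j ∘ trivial
  where
  remaining : ∀ {w} → w ∉ ⊤ - i - j → w ≡ i ⊎ w ≡ j
  remaining {w} w∉ with w Fin.≟ i | w Fin.≟ j
  ... | yes w≡i | _       = inj₁ w≡i
  ... | no _    | yes w≡j = inj₂ w≡j
  ... | no w≢i  | no w≢j  = ⊥-elim (w∉ (Subset.x∈p∧x≢y⇒x∈p-y (Subset.x∈p∧x≢y⇒x∈p-y Subset.∈⊤ w≢i) w≢j))
  trivial : ∀ {x y} → Reach G (⊤ - i - j) x y → x ≡ y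
  trivial (here _) = refl
  trivial (step x∉ x~v r) with remaining x∉ | remaining (reach-head r)
  ... | inj₁ refl | inj₁ refl = ⊥-elim (adj⇒≢ G x~v refl)
  ... | inj₂ refl | inj₂ refl = ⊥-elim (adj⇒≢ G x~v refl)
  ... | inj₁ refl | inj₂ refl = ⊥-elim (Bool.not-¬ x~v i≁j)
  ... | inj₂ refl | inj₁ refl = ⊥-elim (Bool.not-¬ (trans (Graph.sym G i j) x~v) i≁j)

-- Separations

data ExactlyOne : Bool → Bool → Bool → Set where
  first  : ExactlyOne true false false
  second : ExactlyOne false true false
  third  : ExactlyOne false false true

ExactlyOne-swap : ∀ {a b m} → ExactlyOne a b m → ExactlyOne b a m
ExactlyOne-swap first = second
ExactlyOne-swap second = first
ExactlyOne-swap third = third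

ExactlyOne-size : ∀ {a b m} → ExactlyOne a b m → (a ∨ m) · 1 + (b ∨ m) · 1 ≡ 1 + m · 1
ExactlyOne-size first = refl
ExactlyOne-size second = refl
ExactlyOne-size third = refl

ExactlyOne-edge : ∀ {a b m a′ b′ m′} F → ExactlyOne a b m → ExactlyOne a′ b′ m′ →
                  (a ≡ true → b′ ≡ true → F ≡ 0) → (b ≡ true → a′ ≡ true → F ≡ 0) →
                  (a ∨ m) · (a′ ∨ m′) · F + (b ∨ m) · (b′ ∨ m′) · F ≡ F + m · m′ · F
ExactlyOne-edge F first  first  _   _   = refl
ExactlyOne-edge F first  second a-b _   rewrite a-b refl refl = refl
ExactlyOne-edge F first  third  _   _   = refl
ExactlyOne-edge F second first  _   b-a rewrite b-a refl refl = refl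
ExactlyOne-edge F second second _   _   = sym (ℕ.+-identityʳ F)
ExactlyOne-edge F second third  _   _   = sym (ℕ.+-identityʳ F)
ExactlyOne-edge F third  first  _   _   = refl
ExactlyOne-edge F third  second _   _   = sym (ℕ.+-identityʳ F)
ExactlyOne-edge F third  third  _   _   = refl

ExactlyOne-outside : ∀ {a b m} → ExactlyOne a b m → a ∨ m ≢ true → b ≡ true
ExactlyOne-outside first a∨m≢true = ⊥-elim (a∨m≢true refl)
ExactlyOne-outside second _ = refl
ExactlyOne-outside third a∨m≢true = ⊥-elim (a∨m≢true refl)

ExactlyOne-inside : ∀ {a b m} → ExactlyOne a b m → b ≡ true → a ∨ m ≡ false
ExactlyOne-inside second _ = refl

record Separation {n} (G : Graph n) (M A B : Subset n) : Set where
  field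
    partition : ∀ i → ExactlyOne (lookup A i) (lookup B i) (lookup M i)
    no-edge   : ∀ {i j} → i ∈ A → j ∈ B → adj G i j ≡ false

Separation-swap : ∀ {n} {G : Graph n} {M A B} → Separation G M A B → Separation G M B A
Separation-swap {G = G} sep = record
  { partition = ExactlyOne-swap ∘ partition
  ; no-edge   = λ {j} {i} j∈B i∈A → trans (Graph.sym G j i) (no-edge i∈A j∈B)
  }
  where open Separation sep

separation-∣∣< : ∀ {n} {G : Graph n} {M A B} → Separation G M A B → Nonempty B → ∣ A ∪ M ∣ < n
separation-∣∣< {M = M} {A} {B} sep (v , v∈B) = ∉⇒∣∣< (A ∪ M) λ v∈A∪M →
  Bool.not-¬ (trans (sym (lookup-∪ A M v)) (Vec.[]=⇒lookup v∈A∪M))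
    (ExactlyOne-inside (Separation.partition sep v) (Vec.[]=⇒lookup v∈B))

module _ {n} {G : Graph n} {M A B : Subset n} (sep : Separation G M A B) where
  open Separation sep

  separation-sizes : ∣ A ∪ M ∣ + ∣ B ∪ M ∣ ≡ n + ∣ M ∣
  separation-sizes = begin
    ∣ A ∪ M ∣ + ∣ B ∪ M ∣
      ≡⟨ cong₂ _+_ (∣∣≡∑ (A ∪ M)) (∣∣≡∑ (B ∪ M)) ⟩
    ∑[ i < n ] indicator (A ∪ M) i + ∑[ i < n ] indicator (B ∪ M) i
      ≡⟨ ∑-distrib-+ (indicator (A ∪ M)) (indicator (B ∪ M)) ⟨
    ∑[ i < n ] (indicator (A ∪ M) i + indicator (B ∪ M) i)
      ≡⟨ sum-cong-≗ pointwise ⟩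
    ∑[ i < n ] (1 + indicator M i)
      ≡⟨ ∑-distrib-+ (λ _ → 1) (indicator M) ⟩
    ∑[ i < n ] 1 + ∑[ i < n ] indicator M i
      ≡⟨ cong₂ _+_ (∑-ones n) (sym (∣∣≡∑ M)) ⟩
    n + ∣ M ∣
      ∎
    where
    open ≡-Reasoning
    pointwise : ∀ i → indicator (A ∪ M) i + indicator (B ∪ M) i ≡ 1 + indicator M i
    pointwise i rewrite lookup-∪ A M i | lookup-∪ B M i = ExactlyOne-size (partition i)

  separation-edges : e (induced G (A ∪ M)) + e (induced G (B ∪ M)) ≡ e G + e (induced G M)
  separation-edges = begin
    e (induced G (A ∪ M)) + e (induced G (B ∪ M))
      ≡⟨ cong₂ _+_ (e-induced G (A ∪ M)) (e-induced G (B ∪ M)) ⟩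
    ∑[ i < n ] ∑[ j < n ] edgeWithin G (A ∪ M) i j + ∑[ i < n ] ∑[ j < n ] edgeWithin G (B ∪ M) i j
      ≡⟨ ∑∑-distrib-+ (edgeWithin G (A ∪ M)) (edgeWithin G (B ∪ M)) ⟨
    ∑[ i < n ] ∑[ j < n ] (edgeWithin G (A ∪ M) i j + edgeWithin G (B ∪ M) i j)
      ≡⟨ ∑∑-cong pointwise ⟩
    ∑[ i < n ] ∑[ j < n ] (edge G i j + edgeWithin G M i j)
      ≡⟨ ∑∑-distrib-+ (edge G) (edgeWithin G M) ⟩
    ∑[ i < n ] ∑[ j < n ] edge G i j + ∑[ i < n ] ∑[ j < n ] edgeWithin G M i j
      ≡⟨ cong₂ _+_ (e≡∑∑ G) (e-induced G M) ⟨
    e G + e (induced G M)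
      ∎
    where
    open ≡-Reasoning
    pointwise : ∀ i j → edgeWithin G (A ∪ M) i j + edgeWithin G (B ∪ M) i j ≡ edge G i j + edgeWithin G M i j
    pointwise i j rewrite lookup-∪ A M i | lookup-∪ A M j | lookup-∪ B M i | lookup-∪ B M j =
      ExactlyOne-edge (edge G i j) (partition i) (partition j)
        (λ i∈A j∈B → edge-nonAdj G i j (no-edge (Vec.lookup⇒[]= i A i∈A) (Vec.lookup⇒[]= j B j∈B)))
        (λ i∈B j∈A → edge-nonAdj G i j
          (trans (Graph.sym G i j) (no-edge (Vec.lookup⇒[]= j A j∈A) (Vec.lookup⇒[]= i B i∈B))))

module _ {n} {G : Graph n} {M A B : Subset n} (sep : Separation G M A B) (clique : IsClique G M) where
  open Separation sep

  private
    ∈M⇒∈A∪M : ∀ {i} → i ∈ M → i ∈ A ∪ M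
    ∈M⇒∈A∪M i∈M = Subset.x∈p∪q⁺ (inj₂ i∈M)

    ∉A∪M⇒∈B : ∀ {i} → i ∉ A ∪ M → i ∈ B
    ∉A∪M⇒∈B {i} i∉ = Vec.lookup⇒[]= i B (ExactlyOne-outside (partition i)
      λ eq → i∉ (Vec.lookup⇒[]= i (A ∪ M) (trans (lookup-∪ A M i) eq)))

    boundary : ∀ {i j} → i ∈ A ∪ M → j ∉ A ∪ M → adj G i j ≡ true → i ∈ M
    boundary i∈ j∉ i~j with Subset.x∈p∪q⁻ A M i∈
    ... | inj₁ i∈A = ⊥-elim (Bool.not-¬ i~j (no-edge i∈A (∉A∪M⇒∈B j∉)))
    ... | inj₂ i∈M = i∈M

  module _ (S : Subset ∣ A ∪ M ∣) where
    private
      H : Graph ∣ A ∪ M ∣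
      H = induced G (A ∪ M)

      index∉S : ∀ {w} → w ∉ lift (A ∪ M) S → (w∈ : w ∈ A ∪ M) → index (A ∪ M) w∈ ∉ S
      index∉S w∉ w∈ ∈S = w∉ (∈-lift (A ∪ M) S w∈ ∈S)

    -- A path of G that leaves A ∪ M runs through B, so it leaves and re-enters through
    -- the clique M; the excursion can be replaced by a single edge of M.
    reach-inside : ∀ {w y} → Reach G (lift (A ∪ M) S) w y → (w∈ : w ∈ A ∪ M) (y∈ : y ∈ A ∪ M) →
                   Reach H S (index (A ∪ M) w∈) (index (A ∪ M) y∈)
    reach-outside : ∀ {w y} → Reach G (lift (A ∪ M) S) w y → w ∉ A ∪ M → (y∈ : y ∈ A ∪ M) →
                    ∃[ z ] Σ (z ∈ M) λ z∈M → Reach H S (index (A ∪ M) (∈M⇒∈A∪M z∈M)) (index (A ∪ M) y∈)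

    reach-inside (here w∉) w∈ y∈ = subst (Reach H S _) (index-irrelevant (A ∪ M) w∈ y∈) (here (index∉S w∉ w∈))
    reach-inside {w} (step {v = v} w∉ w~v r) w∈ y∈ with v Subset.∈? (A ∪ M)
    ... | yes v∈ = step (index∉S w∉ w∈) (adj-index G (A ∪ M) w∈ v∈ w~v) (reach-inside r v∈ y∈)
    ... | no v∉ with reach-outside r v∉ y∈
    ...   | z , z∈M , z⇝y with w Fin.≟ z
    ...     | yes refl = subst (λ i → Reach H S i _) (index-irrelevant (A ∪ M) _ w∈) z⇝y
    ...     | no w≢z = step (index∉S w∉ w∈)
                (adj-index G (A ∪ M) w∈ _ (clique w z (boundary w∈ v∉ w~v) z∈M w≢z)) z⇝y
    reach-outside (here _) w∉ y∈ = ⊥-elim (w∉ y∈)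
    reach-outside {w} (step {v = v} _ w~v r) w∉ y∈ with v Subset.∈? (A ∪ M)
    ... | yes v∈ = v , v∈M , subst (λ i → Reach H S i _) (index-irrelevant (A ∪ M) v∈ _) (reach-inside r v∈ y∈)
      where
      v∈M : v ∈ M
      v∈M = boundary v∈ w∉ (trans (Graph.sym G v w) w~v)
    ... | no v∉ = reach-outside r v∉ y∈

    vertexCut-lift : VertexCut H S → VertexCut G (lift (A ∪ M) S)
    vertexCut-lift (u , v , u∉S , v∉S , ¬u⇝v) =
      embed (A ∪ M) u , embed (A ∪ M) v , u∉S ∘ embed-∈-lift (A ∪ M) S u , v∉S ∘ embed-∈-lift (A ∪ M) S v ,
      λ r → ¬u⇝v (subst₂ (Reach H S) (index-embed (A ∪ M) u) (index-embed (A ∪ M) v)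
                    (reach-inside r (embed-∈ (A ∪ M) u) (embed-∈ (A ∪ M) v)))

  noΨCut-induced : ∀ Ψ → (∀ S → ¬ ΨCut Ψ G S) → ∀ S → ¬ ΨCut Ψ (induced G (A ∪ M)) S
  noΨCut-induced Ψ noCut S (cut , inΨ) =
    noCut (lift (A ∪ M) S) (vertexCut-lift S cut , inducedIn-lift Ψ G (A ∪ M) S inΨ)

-- Reachability is only decided under a double negation, which suffices since the goal is ⊥.
¬¬-decidable : ∀ {n} (P : Fin n → Set) → ¬ ¬ (∀ i → Dec (P i))
¬¬-decidable {zero} P ¬dec = ¬dec λ ()
¬¬-decidable {suc n} P ¬dec = ¬¬-decidable (P ∘ suc) λ dec →
  ¬¬-excluded-middle λ dec₀ → ¬dec λ { zero → dec₀ ; (suc i) → dec i }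

module _ {n} (G : Graph n) (M : Subset n) {u} (reach? : ∀ i → Dec (Reach G M u i)) where
  reachable unreachable : Subset n
  reachable = tabulate λ i → does (reach? i)
  unreachable = tabulate λ i → not (does (reach? i) ∨ lookup M i)

  reachable⇒ : ∀ {i} → i ∈ reachable → Reach G M u i
  reachable⇒ {i} i∈ with reach? i | trans (sym (Vec.lookup∘tabulate _ i)) (Vec.[]=⇒lookup i∈)
  ... | yes u⇝i | _ = u⇝i

  unreachable⇒ : ∀ {i} → i ∈ unreachable → ¬ Reach G M u i × i ∉ M
  unreachable⇒ {i} i∈ with reach? i | lookup M i in i∈M | trans (sym (Vec.lookup∘tabulate _ i)) (Vec.[]=⇒lookup i∈)
  ... | no u⇏i | false | _ = u⇏i , λ i∈M′ → Bool.not-¬ (Vec.[]=⇒lookup i∈M′) i∈M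

  reach⇒reachable : ∀ {i} → Reach G M u i → i ∈ reachable
  reach⇒reachable {i} u⇝i = Vec.lookup⇒[]= i reachable (trans (Vec.lookup∘tabulate (λ i → does (reach? i)) i) does-yes)
    where
    does-yes : does (reach? i) ≡ true
    does-yes with reach? i
    ... | yes _ = refl
    ... | no u⇏i = ⊥-elim (u⇏i u⇝i)

  unreach⇒unreachable : ∀ {i} → ¬ Reach G M u i → i ∉ M → i ∈ unreachable
  unreach⇒unreachable {i} u⇏i i∉M = Vec.lookup⇒[]= i unreachable (trans (Vec.lookup∘tabulate (λ i → not (does (reach? i) ∨ lookup M i)) i) not-does)
    where
    not-does : not (does (reach? i) ∨ lookup M i) ≡ true
    not-does with reach? i | lookup M i in i∈M
    ... | yes u⇝i | _ = ⊥-elim (u⇏i u⇝i)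
    ... | no _ | true = ⊥-elim (i∉M (Vec.lookup⇒[]= i M i∈M))
    ... | no _ | false = refl

  reachSeparation : Separation G M reachable unreachable
  reachSeparation = record { partition = partition ; no-edge = no-edge }
    where
    partition : ∀ i → ExactlyOne (lookup reachable i) (lookup unreachable i) (lookup M i)
    partition i rewrite Vec.lookup∘tabulate (λ i → does (reach? i)) i
                      | Vec.lookup∘tabulate (λ i → not (does (reach? i) ∨ lookup M i)) i
      with reach? i | lookup M i in i∈M
    ... | yes u⇝i | true  = ⊥-elim (reach-last u⇝i (Vec.lookup⇒[]= i M i∈M))
    ... | yes _   | false = first
    ... | no _    | true  = third
    ... | no _    | false = second
    no-edge : ∀ {i j} → i ∈ reachable → j ∈ unreachable → adj G i j ≡ false
    no-edge {i} {j} i∈ j∈ with adj G i j in i~j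
    ... | false = refl
    ... | true with unreachable⇒ j∈
    ...   | u⇏j , j∉M = ⊥-elim (u⇏j (reach-snoc (reachable⇒ i∈) i~j j∉M))

vertexCut⇒¬¬separation : ∀ {n} (G : Graph n) (M : Subset n) → VertexCut G M →
  ¬ ¬ (∃[ A ] ∃[ B ] (Separation G M A B × Nonempty A × Nonempty B))
vertexCut⇒¬¬separation G M (u , v , u∉M , v∉M , u⇏v) ¬separation =
  ¬¬-decidable (Reach G M u) λ reach? →
    ¬separation (reachable G M reach? , unreachable G M reach? , reachSeparation G M reach? ,
                 (u , reach⇒reachable G M reach? (here u∉M)) ,
                 (v , unreach⇒unreachable G M reach? u⇏v v∉M))

-- Clique cuts of a minimal graph

+≡+∧<⇒< : ∀ {a b n k} → a + b ≡ n + k → b < n → k < a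
+≡+∧<⇒< {a} {b} {n} {k} a+b≡n+k b<n = ℕ.≰⇒> λ a≤k →
  ℕ.<-irrefl a+b≡n+k (subst (a + b <_) (ℕ.+-comm k n) (ℕ.+-mono-≤-< a≤k b<n))

module MinimalGraph (Ψ : Class) (α β : ℝ) (α≤3 : α ≤ᴿ ℕ→ℚ 3) (h : FourAlphaMinusBetaIsSix α β)
                   {n} (G : Graph n) (G∈𝒢 : In𝒢 Ψ α β G) where
  private
    noΨCut : ∀ M → ¬ ΨCut Ψ G M
    noΨCut = proj₂ (proj₂ (proj₁ G∈𝒢))

  ¬QPos-side : ∀ {M A B} → IsClique G M → 3 ≤ ∣ M ∣ → Separation G M A B →
               Nonempty A → Nonempty B → ¬ QPos α β ∣ A ∪ M ∣ (e (induced G (A ∪ M)))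
  ¬QPos-side {M} {A} clique 3≤∣M∣ sep A≠∅ B≠∅ q = ℕ.<⇒≱ (separation-∣∣< sep B≠∅)
    (proj₂ G∈𝒢 _ (induced G (A ∪ M)) (4≤∣A∪M∣ , q , noΨCut-induced sep clique Ψ noΨCut))
    where
    4≤∣A∪M∣ : 4 ≤ ∣ A ∪ M ∣
    4≤∣A∪M∣ = ℕ.≤-<-trans 3≤∣M∣
      (+≡+∧<⇒< (separation-sizes sep) (separation-∣∣< (Separation-swap sep) A≠∅))

  ¬cliqueCut : ∀ {M} → IsClique G M → 3 ≤ ∣ M ∣ → Q₄₆≤Q ∣ M ∣ (pairs ∣ M ∣) → ¬ VertexCut G M
  ¬cliqueCut {M} clique 3≤∣M∣ slack cut =
    vertexCut⇒¬¬separation G M cut λ { (A , B , sep , A≠∅ , B≠∅) →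
      [ ¬QPos-side clique 3≤∣M∣ sep A≠∅ B≠∅
      , ¬QPos-side clique 3≤∣M∣ (Separation-swap sep) B≠∅ A≠∅ ]′ (split sep) }
    where
    edges : ∀ {A B} → Separation G M A B →
            e G + pairs ∣ M ∣ ≡ e (induced G (A ∪ M)) + e (induced G (B ∪ M))
    edges sep = trans (cong (e G +_) (sym (complete⇒e≡pairs (induced G M) (clique⇒complete G M clique))))
                      (sym (separation-edges sep))
    split : ∀ {A B} → Separation G M A B →
            QPos α β (∣ A ∪ M ∣) (e (induced G (A ∪ M))) ⊎ QPos α β (∣ B ∪ M ∣) (e (induced G (B ∪ M)))
    split {A} {B} sep =
      QPos-split α β α≤3 h {∣ M ∣} {pairs ∣ M ∣} slack
        {n} {e G} {∣ A ∪ M ∣} {e (induced G (A ∪ M))} {∣ B ∪ M ∣} {e (induced G (B ∪ M))}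
        (sym (separation-sizes sep)) (edges sep) (proj₁ (proj₂ (proj₁ G∈𝒢)))

  ¬cut-≤2 : ∀ {M} → ∣ M ∣ ≤ 2 → ¬ VertexCut G M
  ¬cut-≤2 {M} ∣M∣≤2 cut =
    noΨCut M (cut , inducedIn-≤3 Ψ G M (ℕ.m≤n⇒m≤1+n ∣M∣≤2) (bipartite-≤2 G M ∣M∣≤2))

  ¬cut-3 : ∀ {M} → ∣ M ∣ ≡ 3 → ¬ VertexCut G M
  ¬cut-3 {M} ∣M∣≡3 cut with clique-or-nonEdge G M
  ... | inj₁ clique =
    ¬cliqueCut clique (ℕ.≤-reflexive (sym ∣M∣≡3)) (subst (λ k → Q₄₆≤Q k (pairs k)) (sym ∣M∣≡3) Q₄₆≤Q₃₃) cut
  ... | inj₂ (x , y , x∈M , y∈M , x≢y , x≁y) = noΨCut M (cut , inducedIn-≤3 Ψ G M ∣M∣≤3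
          (bipartite-nonEdge G M ∣M∣≤3 x∈M y∈M x≢y x≁y))
    where
    ∣M∣≤3 : ∣ M ∣ ≤ 3
    ∣M∣≤3 = ℕ.≤-reflexive ∣M∣≡3

  ¬K₄Cut : ∀ M → ¬ (VertexCut G M × InducedK4 G M)
  ¬K₄Cut M (cut , ∣M∣≡4 , clique) = ¬cliqueCut clique
    (subst (3 ≤_) (sym ∣M∣≡4) (s≤s (s≤s (s≤s z≤n))))
    (subst (λ k → Q₄₆≤Q k (pairs k)) (sym ∣M∣≡4) Q₄₆≤Q₄₆) cut

¬Admissible₄ : ∀ Ψ α β → FourAlphaMinusBetaIsSix α β → (G : Graph 4) → ¬ Admissible Ψ α β G
¬Admissible₄ Ψ α β h G (_ , qG , noΨCut) with clique-or-nonEdge G ⊤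
... | inj₁ complete = ℕ.<-irrefl (complete⇒e≡pairs G λ i j → complete i j Subset.∈⊤ Subset.∈⊤)
                                 (QPos₄⇒<6 α β h {e G} qG)
... | inj₂ (i , j , _ , _ , i≢j , i≁j) = noΨCut (⊤ - i - j)
  (nonEdge-cut G i≢j i≁j , inducedIn-≤3 Ψ G _ (ℕ.m≤n⇒m≤1+n ∣⊤-i-j∣≤2) (bipartite-≤2 G _ ∣⊤-i-j∣≤2))
  where
  ∣⊤-i-j∣≤2 : ∣ ⊤ - i - j ∣ ≤ 2
  ∣⊤-i-j∣≤2 = ℕ.+-cancelˡ-≤ 2 _ _ (∣⊤-i-j∣≤ 4 i≢j)

lemma6 : (Ψ : Class) (α β : ℝ) → ℕ→ℚ 2 <ᴿ α → α ≤ᴿ ℕ→ℚ 3 →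
    FourAlphaMinusBetaIsSix α β →
    ∀ {n} (G : Graph n) → In𝒢 Ψ α β G →
    KConnected 4 G × (∀ M → ¬ (VertexCut G M × InducedK4 G M))
lemma6 Ψ α β _ α≤3 h {n} G G∈𝒢 = (4<n , noSmallCut) , ¬K₄Cut
  where
  open MinimalGraph Ψ α β α≤3 h G G∈𝒢
  4<n : 4 < n
  4<n = ℕ.≤∧≢⇒< (proj₁ (proj₁ G∈𝒢)) λ { refl → ¬Admissible₄ Ψ α β h G (proj₁ G∈𝒢) }
  noSmallCut : ∀ M → ∣ M ∣ < 4 → ¬ VertexCut G M
  noSmallCut M ∣M∣<4 with ℕ.m≤n⇒m<n∨m≡n (ℕ.≤-pred ∣M∣<4)
  ... | inj₁ ∣M∣<3 = ¬cut-≤2 (ℕ.≤-pred ∣M∣<3)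
  ... | inj₂ ∣M∣≡3 = ¬cut-3 ∣M∣≡3
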